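{- Fix $\ell\ge1$ and an $\ell$-tuple of non-negative integers $\vec\alpha$, and let $\hat e_1=(1,0,\dots,0)$. Then $$\sum_{m=0}^\infty M^\ell_m(\vec\alpha,\vec\alpha,t)=M^\ell_0(\vec\alpha+\hat e_1,\vec\alpha,t).$$
   Context: An order-$\ell$ Motzkin path of length $n$ and height $m$ is an integer lattice path from $(0,0)$ to $(n,m)$ using steps $U=(1,1)$ and $D_i=(1,-i)$ for $0\le i\le \ell$, never going below $y=0$. For $\ell$-tuples of non-negative integers $\vec\alpha=(\alpha_0,\dots,\alpha_{\ell-1}),\vec\beta=(\beta_0,\dots,\beta_{\ell-1})$, an $(\vec\alpha,\vec\beta)$-colored Motzkin path is such a path in which, for each $0\le i\le \ell-1$, each $D_i$ step whose right endpoint is at height $0$ is labeled by one of $\alpha_i$ colors and each $D_i$ step whose right endpoint is at height $>0$ is labeled by one of $\beta_i$ colors; $U$ and $D_\ell$ steps are unlabeled. $M^\ell_{n,m}(\vec\alpha,\vec\beta)$ is the number of such colored paths of length $n$ and height $m$, and $M^\ell_m(\vec\alpha,\vec\beta,t)=\sum_{n\ge0}M^\ell_{n,m}(\vec\alpha,\vec\beta)t^n$. -}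

module Defs where

open import Data.Nat using (ℕ; zero; suc; _+_)
open import Data.Fin using (Fin; toℕ)
open import Data.Fin.Base using () renaming (zero to fzero; suc to fsuc)

-- Number of colour choices for a D_i step (i < ℓ) whose RIGHT endpoint is at height h:
-- α i colours if h = 0, β i colours if h > 0.
Color : {ℓ : ℕ} → (α β : Fin ℓ → ℕ) → Fin ℓ → ℕ → Set
Color α β i zero    = Fin (α i)
Color α β i (suc _) = Fin (β i)

-- (α, β)-coloured order-ℓ Motzkin paths starting at (0,0), of length n, ending at height h,
-- built step by step (snoc).  Heights are natural numbers, so the path never goes below y = 0.
--   up    : step U   = (1, 1)
--   down  : step D_i = (1, -i) for i < ℓ, from height h + i to h, carrying a colour
--   downℓ : step D_ℓ = (1, -ℓ), uncoloured
data MPath (ℓ : ℕ) (α β : Fin ℓ → ℕ) : ℕ → ℕ → Set where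
  empty : MPath ℓ α β 0 0
  up    : ∀ {n h} → MPath ℓ α β n h → MPath ℓ α β (suc n) (suc h)
  down  : ∀ {n h} (i : Fin ℓ) → MPath ℓ α β n (h + toℕ i) → Color α β i h → MPath ℓ α β (suc n) h
  downℓ : ∀ {n h} → MPath ℓ α β n (h + ℓ) → MPath ℓ α β (suc n) h

addE1 : {ℓ : ℕ} → (Fin ℓ → ℕ) → Fin ℓ → ℕ
addE1 α fzero    = suc (α fzero)
addE1 α (fsuc i) = α (fsuc i)

-- Cut a path ending at height m at its last passages from height j to j + 1 (j < m). These m
-- up steps raise a floor which the path never goes below afterwards, so measured from that
-- floor the path is a Motzkin path ending at height 0 in which each of them starts at relative
-- height 0. Replacing each of them by a D₀ step ending at height 0 that carries one extra colour
-- is reversible, since with α = β no other step changes its colour count under the shift.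
module Submission where

open import Defs
open import Data.Nat using (ℕ; _≤_; zero; suc; _+_; s≤s; z≤n)
open import Data.Nat.Properties using (suc-injective; +-commutativeSemigroup)
open import Algebra.Properties.CommutativeSemigroup +-commutativeSemigroup using (xy∙z≈xz∙y)
open import Data.Fin using (Fin; toℕ)
open import Data.Fin.Base using () renaming (zero to fzero; suc to fsuc)
open import Data.Product using (Σ; _,_; proj₂; map; map₂)
open import Data.Product.Function.Dependent.Propositional using (Σ-↔)
open import Function.Bundles using (_↔_; mk↔ₛ′)
open import Function.Properties.Inverse using (↔-refl; ↔-trans)
open import Relation.Binary.PropositionalEquality using (_≡_; refl; trans; cong; cong₂)

+-shiftʳ : ∀ {m} h c k → m ≡ h + c → m + k ≡ h + k + c
+-shiftʳ h c k m≡h+c = trans (cong (_+ k) m≡h+c) (xy∙z≈xz∙y h c k)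

module FloorDecomposition {ℓ : ℕ} (α : Fin ℓ → ℕ) where

  -- Floored n h c: paths of length n ending at height h above a floor at height c.
  -- The floor is raised only by `rise`, an up step starting on the floor.
  data Floored : ℕ → ℕ → ℕ → Set where
    empty : Floored 0 0 0
    up    : ∀ {n h c} → Floored n h c → Floored (suc n) (suc h) c
    rise  : ∀ {n c} → Floored n 0 c → Floored (suc n) 0 (suc c)
    down  : ∀ {n h c} (i : Fin ℓ) → Floored n (h + toℕ i) c → Fin (α i) → Floored (suc n) h c
    downℓ : ∀ {n h c} → Floored n (h + ℓ) c → Floored (suc n) h c

  toColour : ∀ {i} h → Fin (α i) → Color α α i h
  toColour zero    x = x
  toColour (suc _) x = x

  fromColour : ∀ {i} h → Color α α i h → Fin (α i)
  fromColour zero    x = x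
  fromColour (suc _) x = x

  fromColour-toColour : ∀ {i} h (x : Fin (α i)) → fromColour h (toColour {i} h x) ≡ x
  fromColour-toColour zero    x = refl
  fromColour-toColour (suc _) x = refl

  toColour-fromColour : ∀ {i} h (x : Color α α i h) → toColour h (fromColour h x) ≡ x
  toColour-fromColour zero    x = refl
  toColour-fromColour (suc _) x = refl

  toMPath : ∀ {n h c m} → Floored n h c → m ≡ h + c → MPath ℓ α α n m
  toMPath empty                         refl = empty
  toMPath (up s)                        refl = up (toMPath s refl)
  toMPath (rise s)                      refl = up (toMPath s refl)
  toMPath {h = h} {c} {m} (down i s x)  eq   = down i (toMPath s (+-shiftʳ h c (toℕ i) eq)) (toColour m x)
  toMPath {h = h} {c} (downℓ s)         eq   = downℓ (toMPath s (+-shiftʳ h c ℓ eq))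

  -- An up step ending on the floor is a `rise`: it is the last passage to that height.
  fromMPath : ∀ {n m} → MPath ℓ α α n m → ∀ h c → m ≡ h + c → Floored n h c
  fromMPath empty                zero    zero    _  = empty
  fromMPath (up p)               (suc h) c       eq = up (fromMPath p h c (suc-injective eq))
  fromMPath (up p)               zero    (suc c) eq = rise (fromMPath p zero c (suc-injective eq))
  fromMPath {m = m} (down i p x) h       c       eq =
    down i (fromMPath p (h + toℕ i) c (+-shiftʳ h c (toℕ i) eq)) (fromColour m x)
  fromMPath (downℓ p)            h       c       eq = downℓ (fromMPath p (h + ℓ) c (+-shiftʳ h c ℓ eq))

  fromMPath-toMPath : ∀ {n h c m} (s : Floored n h c) (eq eq′ : m ≡ h + c) →
                      fromMPath (toMPath s eq) h c eq′ ≡ s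
  fromMPath-toMPath empty                 refl _ = refl
  fromMPath-toMPath (up s)                refl _ = cong up (fromMPath-toMPath s refl _)
  fromMPath-toMPath (rise s)              refl _ = cong rise (fromMPath-toMPath s refl _)
  fromMPath-toMPath {m = m} (down i s x)  _    _ =
    cong₂ (down i) (fromMPath-toMPath s _ _) (fromColour-toColour m x)
  fromMPath-toMPath (downℓ s)             _    _ = cong downℓ (fromMPath-toMPath s _ _)

  toMPath-fromMPath : ∀ {n m} (p : MPath ℓ α α n m) h c (eq eq′ : m ≡ h + c) →
                      toMPath (fromMPath p h c eq) eq′ ≡ p
  toMPath-fromMPath empty                zero    zero    _ refl = refl
  toMPath-fromMPath (up p)               (suc h) c       _ refl = cong up (toMPath-fromMPath p h c _ refl)
  toMPath-fromMPath (up p)               zero    (suc c) _ refl = cong up (toMPath-fromMPath p zero c _ refl)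
  toMPath-fromMPath {m = m} (down i p x) h       c       _ _    =
    cong₂ (down i) (toMPath-fromMPath p (h + toℕ i) c _ _) (toColour-fromColour m x)
  toMPath-fromMPath (downℓ p)            h       c       _ _    = cong downℓ (toMPath-fromMPath p (h + ℓ) c _ _)

  MPath↔Floored : ∀ n h c → MPath ℓ α α n (h + c) ↔ Floored n h c
  MPath↔Floored n h c = mk↔ₛ′ (λ p → fromMPath p h c refl) (λ s → toMPath s refl)
    (λ s → fromMPath-toMPath s refl refl) (λ p → toMPath-fromMPath p h c refl refl)

module Recolouring {k : ℕ} (α : Fin (suc k) → ℕ) where

  open FloorDecomposition α

  -- The colour fzero of D₀ steps ending at height 0 is the new one; the old ones are shifted.
  oldColour : ∀ i h → Fin (α i) → Color (addE1 α) α i h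
  oldColour i        (suc h) x = x
  oldColour fzero    zero    x = fsuc x
  oldColour (fsuc i) zero    x = x

  recolour : ∀ {n h c} → Floored n h c → MPath (suc k) (addE1 α) α n h
  recolour empty                = empty
  recolour (up s)               = up (recolour s)
  recolour (rise s)             = down fzero (recolour s) fzero
  recolour {h = h} (down i s x) = down i (recolour s) (oldColour i h x)
  recolour (downℓ s)            = downℓ (recolour s)

  unrecolour : ∀ {n h} → MPath (suc k) (addE1 α) α n h → Σ ℕ (Floored n h)
  unrecolour empty                                  = 0 , empty
  unrecolour (up p)                                 = map₂ up (unrecolour p)
  unrecolour (down {h = zero}  fzero    p fzero)    = map suc rise (unrecolour p)
  unrecolour (down {h = zero}  fzero    p (fsuc x)) = map₂ (λ s → down fzero s x) (unrecolour p)
  unrecolour (down {h = zero}  (fsuc i) p x)        = map₂ (λ s → down (fsuc i) s x) (unrecolour p)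
  unrecolour (down {h = suc _} i        p x)        = map₂ (λ s → down i s x) (unrecolour p)
  unrecolour (downℓ p)                              = map₂ downℓ (unrecolour p)

  unrecolour-recolour : ∀ {n h c} (s : Floored n h c) → unrecolour (recolour s) ≡ (c , s)
  unrecolour-recolour empty                          = refl
  unrecolour-recolour (up s)                         = cong (map₂ up) (unrecolour-recolour s)
  unrecolour-recolour (rise s)                       = cong (map suc rise) (unrecolour-recolour s)
  unrecolour-recolour (down {h = zero}  fzero    s x) = cong (map₂ (λ s → down fzero s x)) (unrecolour-recolour s)
  unrecolour-recolour (down {h = zero}  (fsuc i) s x) = cong (map₂ (λ s → down (fsuc i) s x)) (unrecolour-recolour s)
  unrecolour-recolour (down {h = suc _} i        s x) = cong (map₂ (λ s → down i s x)) (unrecolour-recolour s)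
  unrecolour-recolour (downℓ s)                      = cong (map₂ downℓ) (unrecolour-recolour s)

  recolour-unrecolour : ∀ {n h} (p : MPath (suc k) (addE1 α) α n h) → recolour (proj₂ (unrecolour p)) ≡ p
  recolour-unrecolour empty                                  = refl
  recolour-unrecolour (up p)                                 = cong up (recolour-unrecolour p)
  recolour-unrecolour (down {h = zero}  fzero    p fzero)    = cong (λ q → down fzero q fzero) (recolour-unrecolour p)
  recolour-unrecolour (down {h = zero}  fzero    p (fsuc x)) = cong (λ q → down fzero q (fsuc x)) (recolour-unrecolour p)
  recolour-unrecolour (down {h = zero}  (fsuc i) p x)        = cong (λ q → down (fsuc i) q x) (recolour-unrecolour p)
  recolour-unrecolour (down {h = suc _} i        p x)        = cong (λ q → down i q x) (recolour-unrecolour p)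
  recolour-unrecolour (downℓ p)                              = cong downℓ (recolour-unrecolour p)

  Floored↔recoloured : ∀ n h → Σ ℕ (Floored n h) ↔ MPath (suc k) (addE1 α) α n h
  Floored↔recoloured n h = mk↔ₛ′ (λ (_ , s) → recolour s) unrecolour
    recolour-unrecolour (λ (_ , s) → unrecolour-recolour s)

theorem2p5 : (ℓ : ℕ) → 1 ≤ ℓ → (α : Fin ℓ → ℕ) → (n : ℕ) →
    (Σ ℕ (λ m → MPath ℓ α α n m)) ↔ MPath ℓ (addE1 α) α n 0
theorem2p5 (suc k) (s≤s z≤n) α n =
  ↔-trans (Σ-↔ ↔-refl (MPath↔Floored n 0 _)) (Floored↔recoloured n 0)
  where
    open FloorDecomposition α
    open Recolouring α
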